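{- Let $\circ\in\{\land,\lor\}$, let $n \in \mathbb N$ and let $S$ be the leftist circuit over $\{\circ\}$ on inputs $x_0, \dotsc, x_{n-1}$. Let $K \subseteq \{x_0,\dots,x_{n-1}\}$ be a triangular set of inputs with boundary vertices $B := B(K, S)$. Furthermore, let a set $L$ of further inputs (not necessarily inputs of $S$) with $K \cap L = \emptyset$ be given. Consider arrival times $a(y) = 0$ for each $y \in K$ and $a(y) \in \mathbb N$ for each $y \in L$. Then a delay-optimum symmetric $\circ$-tree on $K \cup L$ with respect to the arrival times $a$ can be constructed, possibly reusing the gates of $S$, using at most $|B| + |L| - 1$ gates that are not gates of $S$.
   Context: Circuits: a circuit over $\{\circ\}$ on inputs $x_0,\dots,x_{n-1}$ is a finite directed acyclic graph whose sources are the input vertices and whose other vertices are gates, each with exactly two predecessors, computing $\circ$ of their values. For a vertex $v$, $\mathrm{In}_v(S)$ is the set of input vertices from which there is a directed path to $v$ ($\mathrm{In}_v(S)=\{v\}$ for an input). The depth of a vertex is the maximum number of edges on a directed path from an input to it. Leftist circuit: the circuit $S$ on $x_0,\dots,x_{n-1}$ constructed as follows. Set $i=0$, $M=n$; while $M \ge 2$: let $k$ be maximal with $2^k\le M$, add a perfect binary tree of $\circ$-gates of depth $k$ whose leaves, read from left to right, are $x_i,\dots,x_{i+2^k-1}$, then set $i\leftarrow i+2^k$, $M\leftarrow M-2^k$. Each vertex $v$ has $\mathrm{In}_v(S)=\{x_j: j\in I_v\}$ for an index interval $I_v$; $v$ is left of $w$ if $I_v\cap I_w=\emptyset$ and $\max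 I_v<\min I_w$. Boundary vertices: for $K\subseteq\{x_0,\dots,x_{n-1}\}$, $B(K,S)=\{v : \mathrm{In}_v(S)\subseteq K \text{ and } \mathrm{In}_w(S)\not\subseteq K \text{ for every successor } w \text{ of } v\}$. The boundary tree sequence $T_0,\dots,T_{|B|-1}$ of $K$ consists of the subcircuits formed by each boundary vertex $b$ together with all vertices having a directed path to $b$ (perfect binary trees), ordered from left to right; $\mathrm{depth}(T_j)$ is the depth of its root. $K$ is triangular if there is $J\in\{0,\dots,|B|-1\}$ such that the inputs of $T_0,\dots,T_J$ form a set of inputs with consecutive indices, the inputs of $T_{J+1},\dots,T_{|B|-1}$ form a set of inputs with consecutive indices, $\mathrm{depth}(T_j)<\mathrm{depth}(T_{j+1})$ for $0\le j<J-1$, and $\mathrm{depth}(T_j)>\mathrm{depth}(T_{j+1})$ for $J+1\le j<|B|-1$; the empty set is also triangular. Symmetric trees and delay: a symmetric $\circ$-tree on an input set $X$ is a circuit over $\{\circ\}$ whose underlying graph is a tree with leaves exactly $X$, computing the $\circ$ of all elements of $X$. Given arrival times $a\colon X\to\mathbb N$, the delay of a circuit is the maximum over inputs $x$ of $a(x)$ plus the maximum number of edges on a directed path starting at $x$. Delay-optimum means minimum delay among all symmetric $\circ$-trees on $X$. -}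

module Defs where

open import Data.Nat using (ℕ; zero; suc; _+_; _*_; _∸_; _^_; _≤_; _<_; _<ᵇ_; _⊔_)
open import Data.Nat.Properties using (≤-trans; ≤-reflexive; +-comm; +-assoc; +-identityʳ; m≤m+n)
open import Data.Nat.Logarithm using (⌊log₂_⌋)
open import Data.Nat.Divisibility using (_∣_)
open import Data.Bool using (if_then_else_)
open import Data.Fin using (Fin; toℕ; fromℕ<)
open import Data.Fin.Subset using (Subset; ∣_∣) renaming (_∈_ to _∈ₛ_; _∉_ to _∉ₛ_)
open import Data.List using (List; []; _∷_; _++_; length; lookup)
open import Data.List.Membership.Propositional using (_∈_)
open import Data.List.Relation.Unary.Unique.Propositional using (Unique)
open import Data.List.Relation.Unary.Linked using (Linked)
open import Data.Sum using (_⊎_; inj₁; inj₂)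
open import Data.Product using (Σ; _×_; ∃; ∃-syntax; _,_)
open import Relation.Binary.PropositionalEquality using (_≡_; sym; trans; cong)
open import Relation.Nullary using (¬_)
open import Function.Bundles using (_⇔_)

-- The operation ∘ ∈ {∧, ∨}.  (Combinatorially irrelevant; kept for fidelity.)

data Op : Set where
  ∧op ∨op : Op

-- Blocks: list of (start index i, depth k) of the perfect binary trees,
-- produced by: while M ≥ 2, k := max k with 2^k ≤ M (= ⌊log₂ M⌋), ...
-- Fuel n suffices since M decreases by ≥ 1 in every step.

blocksGo : (fuel i M : ℕ) → List (ℕ × ℕ)
blocksGo zero    i M = []
blocksGo (suc f) i M =
  if M <ᵇ 2 then []
  else ((i , ⌊log₂ M ⌋) ∷ blocksGo f (i + 2 ^ ⌊log₂ M ⌋) (M ∸ 2 ^ ⌊log₂ M ⌋))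

leftistBlocks : ℕ → List (ℕ × ℕ)
leftistBlocks n = blocksGo n 0 n

-- A vertex of S is described by (j , h): the vertex of height h whose
-- input interval is I_v = [j , j + 2^h).  Height 0 = the input x_j.
record Vtx : Set where
  constructor vtx
  field
    start  : ℕ
    height : ℕ
open Vtx public

vend : Vtx → ℕ
vend v = start v + 2 ^ height v

_∈I_ : ℕ → Vtx → Set
i ∈I v = start v ≤ i × i < vend v

-- v is a vertex of the leftist circuit S on n inputs:
-- either an input x_j (j < n), or a gate of some perfect tree (s , k) in
-- the decomposition, of height 1 ≤ h ≤ k, aligned inside the block.
IsVertex : ℕ → Vtx → Set
IsVertex n (vtx j zero)    = j < n
IsVertex n (vtx j (suc h)) =
  Σ (ℕ × ℕ) λ b → let s = Data.Product.proj₁ b ; k = Data.Product.proj₂ b in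
    b ∈ leftistBlocks n × suc h ≤ k × s ≤ j × 2 ^ suc h ∣ (j ∸ s) × j + 2 ^ suc h ≤ s + 2 ^ k

-- Edge v → w of S: w is a gate of S, and v is its left child (same start,
-- height one less) or its right child (start shifted by 2^{height v}).
IsPred : ℕ → Vtx → Vtx → Set
IsPred n v w =
  IsVertex n w × height w ≡ suc (height v) ×
  (start v ≡ start w ⊎ start v ≡ start w + 2 ^ height v)

InSub : ∀ {n} → Subset n → Vtx → Set
InSub {n} K v = (i : Fin n) → toℕ i ∈I v → i ∈ₛ K

IsBoundary : ∀ {n} → Subset n → Vtx → Set
IsBoundary {n} K v = IsVertex n v × InSub K v × (∀ w → IsPred n v w → ¬ InSub K w)

LeftOf : Vtx → Vtx → Set
LeftOf v w = vend v ≤ start w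

Consecutive : (ℕ → Set) → Set
Consecutive P = Σ ℕ λ a → Σ ℕ λ b → ∀ i → P i ⇔ (a ≤ i × i < b)

-- K is triangular, where bs is the boundary tree sequence T_0 … T_{|B|-1}
-- (listed by their roots, ordered from left to right).
Triangular : ∀ {n} → Subset n → List Vtx → Set
Triangular {n} K bs =
  (∀ (i : Fin n) → i ∉ₛ K) ⊎
  Σ (Fin (length bs)) λ J →
      Consecutive (λ i → Σ (Fin (length bs)) λ t → toℕ t ≤ toℕ J × i ∈I lookup bs t)
    × Consecutive (λ i → Σ (Fin (length bs)) λ t → toℕ J < toℕ t × i ∈I lookup bs t)
    × (∀ (t t' : Fin (length bs)) → toℕ t' ≡ suc (toℕ t) →
         suc (toℕ t) < toℕ J →
         height (lookup bs t) < height (lookup bs t'))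
    × (∀ (t t' : Fin (length bs)) → toℕ t' ≡ suc (toℕ t) →
         toℕ J < toℕ t →
         height (lookup bs t') < height (lookup bs t))

data BTree (A : Set) : Set where
  leaf : A → BTree A
  node : BTree A → BTree A → BTree A

leaves : ∀ {A} → BTree A → List A
leaves (leaf x)   = x ∷ []
leaves (node l r) = leaves l ++ leaves r

-- delay: max over leaves x of a(x) + length of the (unique) path x ⇝ root
delay : ∀ {A} → (A → ℕ) → BTree A → ℕ
delay a (leaf x)   = a x
delay a (node l r) = suc (delay a l ⊔ delay a r)

IsSymTree : ∀ {A} → (A → Set) → BTree A → Set
IsSymTree {A} X t = Unique (leaves t) × (∀ (x : A) → (x ∈ leaves t) ⇔ X x)

Inp : ℕ → ℕ → Set
Inp n m = Fin n ⊎ Fin m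

-- K ∪ L, where L = {x_i : i ∈ L₁} ∪ {y_i : i ∈ L₂}
InKL : ∀ {n m} → Subset n → Subset n → Subset m → Inp n m → Set
InKL K L₁ L₂ (inj₁ i) = i ∈ₛ K ⊎ i ∈ₛ L₁
InKL K L₁ L₂ (inj₂ i) = i ∈ₛ L₂

-- Trees that may reuse vertices of S.  `old j h p` is the vertex (j , h)
-- of S together with everything above it in S (a perfect tree on the
-- inputs x_j … x_{j+2^h-1}); `new` is a freshly added ∘-gate.

perfect : ∀ {n} (j h : ℕ) → j + 2 ^ h ≤ n → BTree (Fin n)
perfect j zero    p = leaf (fromℕ< (≤-trans (≤-reflexive (+-comm 1 j)) p))
perfect {n} j (suc h) p = node (perfect j h p₁) (perfect (j + 2 ^ h) h p₂)
  where
  eq : j + 2 ^ h + 2 ^ h ≡ j + 2 ^ suc h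
  eq = trans (+-assoc j (2 ^ h) (2 ^ h))
             (cong (λ z → j + (2 ^ h + z)) (sym (+-identityʳ (2 ^ h))))
  p₂ : j + 2 ^ h + 2 ^ h ≤ n
  p₂ = ≤-trans (≤-reflexive eq) p
  p₁ : j + 2 ^ h ≤ n
  p₁ = ≤-trans (m≤m+n (j + 2 ^ h) (2 ^ h)) p₂

data RTree (n m : ℕ) : Set where
  inp : Inp n m → RTree n m
  old : (j h : ℕ) → j + 2 ^ h ≤ n → RTree n m
  new : RTree n m → RTree n m → RTree n m

mapB : ∀ {A B : Set} → (A → B) → BTree A → BTree B
mapB f (leaf x)   = leaf (f x)
mapB f (node l r) = node (mapB f l) (mapB f r)

expand : ∀ {n m} → RTree n m → BTree (Inp n m)
expand (inp x)     = leaf x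
expand (old j h p) = mapB inj₁ (perfect j h p)
expand (new l r)   = node (expand l) (expand r)

ReusesS : ∀ {n m} → RTree n m → Set
ReusesS {n} (inp x)     = Data.Unit.⊤
  where import Data.Unit
ReusesS {n} (old j h p) = IsVertex n (vtx j h)
ReusesS {n} (new l r)   = ReusesS l × ReusesS r

newGates : ∀ {n m} → RTree n m → ℕ
newGates (inp x)     = 0
newGates (old j h p) = 0
newGates (new l r)   = suc (newGates l + newGates r)

-- Each boundary vertex b of K roots a perfect tree of S of depth depth(b) whose inputs
-- arrive at time 0, and each further input y is a one-leaf tree of delay a(y); merging these
-- |B| + |L| pieces into one tree takes |B| + |L| − 1 new gates. Give a piece of level d the
-- weight 2^d; the total weight W is at most the sum of 2^a(x) over all inputs x. In each
-- round the pieces of level 0 are paired by new gates and all other levels drop by one,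
-- which halves W rounded up, so after e rounds with W ≤ 2^e a single tree of delay at most e
-- remains. By Kraft's inequality the sum of 2^a(x) over the leaves of a tree of delay d is
-- at most 2^d, so no symmetric tree on K ∪ L beats the least such e.
module Submission where

open import Defs
open import Data.Nat using (ℕ; _+_; _∸_; _≤_)
open import Data.Fin using (Fin)
open import Data.Fin.Subset using (Subset; ∣_∣; Empty; _∩_) renaming (_∈_ to _∈ₛ_)
open import Data.List using (List; length)
open import Data.List.Membership.Propositional using (_∈_)
open import Data.List.Relation.Unary.Linked using (Linked)
open import Data.Sum using (inj₁)
open import Data.Product using (Σ; _×_)
open import Relation.Binary.PropositionalEquality using (_≡_)
open import Function.Bundles using (_⇔_)

open import Data.Bool using (true; false)
open import Data.Empty using (⊥-elim)
open import Data.Fin as Fin using (toℕ)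
open import Data.Fin.Properties using (toℕ-fromℕ<; toℕ-injective; toℕ<n)
open import Data.Fin.Subset.Properties using (_∈?_; x∈p∩q⁺)
import Data.Fin.Properties as Finₚ
open import Data.List
  using ([]; _∷_; _++_; map; concat; concatMap)
open import Data.List.Properties
  using (map-++; concat-++; length-++; length-map; ++-assoc; ++-identityʳ)
open import Data.List.Membership.Propositional using (find; lose)
open import Data.List.Membership.Propositional.Properties
  using (∈-++⁻; ∈-++⁺ˡ; ∈-++⁺ʳ; ∈-map⁺; ∈-map⁻)
open import Data.List.Membership.Propositional.Properties.WithK using (unique∧set⇒bag)
open import Data.List.Relation.Binary.BagAndSetEquality using (∼bag⇒↭)
open import Data.List.Relation.Binary.Disjoint.Propositional using (Disjoint)
open import Data.List.Relation.Binary.Permutation.Propositional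
  using (_↭_; ↭-refl; ↭-sym; ↭-trans; ↭-reflexive; ↭⇒↭ₛ)
open import Data.List.Relation.Binary.Permutation.Propositional.Properties
  using (∈-resp-↭; ++⁺ˡ; shifts)
import Data.List.Relation.Binary.Permutation.Propositional.Properties as ↭
import Data.List.Relation.Binary.Permutation.Setoid.Properties as ↭ₛ
open import Data.List.Relation.Unary.All using (All; []; _∷_)
import Data.List.Relation.Unary.All as All
import Data.List.Relation.Unary.All.Properties as All
open import Data.List.Relation.Unary.AllPairs using (AllPairs; []; _∷_)
import Data.List.Relation.Unary.AllPairs as AllPairs
import Data.List.Relation.Unary.AllPairs.Properties as AllPairs
open import Data.List.Relation.Unary.Any using (here; there; any?)
open import Data.List.Relation.Unary.Linked.Properties using (Linked⇒AllPairs)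
open import Data.List.Relation.Unary.Unique.Propositional using (Unique)
import Data.List.Relation.Unary.Unique.Propositional.Properties as Unique
open import Data.Maybe using (Maybe; just; nothing)
open import Data.Nat
  using (zero; suc; _*_; _^_; _<_; _⊔_; z≤n; s≤s; z<s; _≤?_; _<?_; _≟_; NonZero; ⌊_/2⌋; ⌈_/2⌉)
open import Data.Nat.Divisibility using (_∣?_)
open import Data.Nat.Induction using (<-wellFounded)
open import Data.Nat.ListAction using (sum)
open import Data.Nat.ListAction.Properties using (sum-++; sum-↭)
open import Data.Nat.Logarithm using (⌊log₂_⌋)
open import Data.Nat.Logarithm.Core using (⌊log2⌋)
open import Data.Nat.Properties
open import Data.Product using (_,_; proj₁; proj₂)
open import Data.Sum using (inj₂)
open import Data.Sum.Properties using (inj₁-injective; inj₂-injective)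
open import Data.Unit using (tt)
open import Data.Vec using ([]; _∷_; here; there)
open import Function using (_∘_; id)
open import Function.Bundles using (mk⇔; module Equivalence)
open import Induction.WellFounded using (Acc; acc)
open import Relation.Binary.PropositionalEquality
  using (refl; sym; trans; cong; cong₂; subst; setoid; module ≡-Reasoning)
open import Relation.Nullary using (Dec; yes; no; contradiction)
open import Relation.Nullary.Decidable using (_×-dec_; _⊎-dec_; _→-dec_; map′)
open import Relation.Unary using (Decidable)

open import Algebra.Properties.CommutativeSemigroup +-commutativeSemigroup using (x∙yz≈y∙xz)

open Equivalence using (to; from)

private variable
  A B : Set
  n m : ℕ
  vs : List Vtx

n<2^n : ∀ n → n < 2 ^ n
n<2^n zero    = z<s
n<2^n (suc n) = +-mono-≤ (m^n>0 2 n) (≤-trans (n<2^n n) (m≤m+n (2 ^ n) 0))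

j+2^h+2^h≡j+2^[1+h] : ∀ j h → j + 2 ^ h + 2 ^ h ≡ j + 2 ^ suc h
j+2^h+2^h≡j+2^[1+h] j h =
  trans (+-assoc j (2 ^ h) (2 ^ h)) (cong (λ z → j + (2 ^ h + z)) (sym (+-identityʳ (2 ^ h))))

2*x≤1+2*y⇒x≤y : ∀ {x y} → 2 * x ≤ suc (2 * y) → x ≤ y
2*x≤1+2*y⇒x≤y {x} {y} p =
  ≤-pred (*-cancelˡ-< 2 x (suc y) (≤-trans (s≤s p) (≤-reflexive (sym (*-suc 2 y)))))

2*⌊n/2⌋≤n : ∀ n → 2 * ⌊ n /2⌋ ≤ n
2*⌊n/2⌋≤n n = begin
  ⌊ n /2⌋ + (⌊ n /2⌋ + 0) ≡⟨ cong (⌊ n /2⌋ +_) (+-identityʳ ⌊ n /2⌋) ⟩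
  ⌊ n /2⌋ + ⌊ n /2⌋       ≤⟨ +-monoʳ-≤ ⌊ n /2⌋ (⌊n/2⌋≤⌈n/2⌉ n) ⟩
  ⌊ n /2⌋ + ⌈ n /2⌉       ≡⟨ ⌊n/2⌋+⌈n/2⌉≡n n ⟩
  n                       ∎
  where open ≤-Reasoning

2^⌊log₂n⌋≤n : ∀ n → .{{NonZero n}} → 2 ^ ⌊log₂ n ⌋ ≤ n
2^⌊log₂n⌋≤n (suc n) = go n (<-wellFounded (suc n))
  where
  go : ∀ n (rec : Acc _<_ (suc n)) → 2 ^ ⌊log2⌋ (suc n) rec ≤ suc n
  go zero    _        = ≤-refl
  go (suc n) (acc rs) = ≤-trans (*-monoʳ-≤ 2 (go ⌊ n /2⌋ (rs (⌊n/2⌋<n (suc n)))))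
                                (2*⌊n/2⌋≤n (suc (suc n)))

least-witness : {P : ℕ → Set} → Decidable P → ∀ {w} → P w →
                Σ ℕ λ e → P e × (∀ {d} → P d → e ≤ d)
least-witness P? {zero} pw = 0 , pw , λ _ → z≤n
least-witness P? {suc w} pw with P? 0
... | yes p0 = 0 , p0 , λ _ → z≤n
... | no ¬p0 =
  let e , pe , least = least-witness (P? ∘ suc) {w} pw in
  suc e , pe , λ { {zero} p → contradiction p ¬p0 ; {suc d} p → s≤s (least p) }

least-exponent : ∀ W → Σ ℕ λ e → W ≤ 2 ^ e × (∀ {d} → W ≤ 2 ^ d → e ≤ d)
least-exponent W = least-witness (λ e → W ≤? 2 ^ e) {W} (<⇒≤ (n<2^n W))

members : Subset n → List (Fin n)
members []          = []
members (true ∷ p)  = Fin.zero ∷ map Fin.suc (members p)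
members (false ∷ p) = map Fin.suc (members p)

∈-members⁻ : ∀ (p : Subset n) {i} → i ∈ members p → i ∈ₛ p
∈-members⁻ (true ∷ p) (here refl) = here
∈-members⁻ (true ∷ p) (there i∈) with ∈-map⁻ Fin.suc i∈
... | _ , j∈ , refl = there (∈-members⁻ p j∈)
∈-members⁻ (false ∷ p) i∈ with ∈-map⁻ Fin.suc i∈
... | _ , j∈ , refl = there (∈-members⁻ p j∈)

∈-members⁺ : ∀ (p : Subset n) {i} → i ∈ₛ p → i ∈ members p
∈-members⁺ (true ∷ p)  here       = here refl
∈-members⁺ (true ∷ p)  (there i∈) = there (∈-map⁺ Fin.suc (∈-members⁺ p i∈))
∈-members⁺ (false ∷ p) (there i∈) = ∈-map⁺ Fin.suc (∈-members⁺ p i∈)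

members-unique : ∀ (p : Subset n) → Unique (members p)
members-unique []          = []
members-unique (true ∷ p)  =
  All.map⁺ (All.universal (λ _ ()) (members p))
  ∷ Unique.map⁺ Finₚ.suc-injective (members-unique p)
members-unique (false ∷ p) = Unique.map⁺ Finₚ.suc-injective (members-unique p)

length-members : ∀ (p : Subset n) → length (members p) ≡ ∣ p ∣
length-members []          = refl
length-members (true ∷ p)  = cong suc (trans (length-map Fin.suc (members p)) (length-members p))
length-members (false ∷ p) = trans (length-map Fin.suc (members p)) (length-members p)

inj₁-∈-++⁻ : ∀ {i : A} {xs : List A} {ys : List B} →
                  inj₁ i ∈ map inj₁ xs ++ map inj₂ ys → i ∈ xs
inj₁-∈-++⁻ {xs = xs} i∈ with ∈-++⁻ (map inj₁ xs) i∈
... | inj₁ i∈ˡ with ∈-map⁻ inj₁ i∈ˡ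
...   | _ , j∈ , refl = j∈
inj₁-∈-++⁻ {xs = xs} i∈ | inj₂ i∈ʳ with ∈-map⁻ inj₂ i∈ʳ
...   | _ , _ , ()

inj₂-∈-++⁻ : ∀ {j : B} {xs : List A} {ys : List B} →
                  inj₂ j ∈ map inj₁ xs ++ map inj₂ ys → j ∈ ys
inj₂-∈-++⁻ {xs = xs} j∈ with ∈-++⁻ (map inj₁ xs) j∈
... | inj₁ j∈ˡ with ∈-map⁻ inj₁ j∈ˡ
...   | _ , _ , ()
inj₂-∈-++⁻ {xs = xs} j∈ | inj₂ j∈ʳ with ∈-map⁻ inj₂ j∈ʳ
...   | _ , k∈ , refl = k∈

unique-map-inj₁-++-map-inj₂ : {xs : List A} {ys : List B} → Unique xs → Unique ys →
                      Unique (map inj₁ xs ++ map inj₂ ys)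
unique-map-inj₁-++-map-inj₂ {xs = xs} {ys} uxs uys =
  Unique.++⁺ (Unique.map⁺ inj₁-injective uxs) (Unique.map⁺ inj₂-injective uys) disjoint
  where
  disjoint : Disjoint (map inj₁ xs) (map inj₂ ys)
  disjoint (v∈ˡ , v∈ʳ) with ∈-map⁻ inj₁ v∈ˡ | ∈-map⁻ inj₂ v∈ʳ
  ... | _ , _ , refl | _ , _ , ()

unique-resp-↭ : {xs ys : List A} → Unique xs → xs ↭ ys → Unique ys
unique-resp-↭ u p = ↭ₛ.Unique-resp-↭ (setoid _) (↭⇒↭ₛ p) u

-- Trees, delay and Kraft's inequality

leaves-mapB : ∀ (f : A → B) t → leaves (mapB f t) ≡ map f (leaves t)
leaves-mapB f (leaf x)   = refl
leaves-mapB f (node l r) =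
  trans (cong₂ _++_ (leaves-mapB f l) (leaves-mapB f r)) (sym (map-++ f (leaves l) (leaves r)))

delay-mapB : ∀ (f : A → B) (a : B → ℕ) t → delay a (mapB f t) ≡ delay (a ∘ f) t
delay-mapB f a (leaf x)   = refl
delay-mapB f a (node l r) = cong suc (cong₂ _⊔_ (delay-mapB f a l) (delay-mapB f a r))

kraftSum : (A → ℕ) → List A → ℕ
kraftSum a xs = sum (map (λ x → 2 ^ a x) xs)

kraftSum-++ : ∀ (a : A → ℕ) xs ys → kraftSum a (xs ++ ys) ≡ kraftSum a xs + kraftSum a ys
kraftSum-++ a xs ys = trans (cong sum (map-++ _ xs ys)) (sum-++ (map _ xs) _)

kraftSum-↭ : ∀ (a : A → ℕ) {xs ys} → xs ↭ ys → kraftSum a xs ≡ kraftSum a ys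
kraftSum-↭ a p = sum-↭ (↭.map⁺ _ p)

length≤kraftSum : ∀ (a : A → ℕ) xs → length xs ≤ kraftSum a xs
length≤kraftSum a []       = z≤n
length≤kraftSum a (x ∷ xs) = +-mono-≤ (m^n>0 2 (a x)) (length≤kraftSum a xs)

kraft : ∀ (a : A → ℕ) t → kraftSum a (leaves t) ≤ 2 ^ delay a t
kraft a (leaf x)   = ≤-reflexive (+-identityʳ (2 ^ a x))
kraft a (node l r) = begin
  kraftSum a (leaves l ++ leaves r)       ≡⟨ kraftSum-++ a (leaves l) (leaves r) ⟩
  kraftSum a (leaves l) + kraftSum a (leaves r)
    ≤⟨ +-mono-≤ (≤-trans (kraft a l) (^-monoʳ-≤ 2 (m≤m⊔n dl dr)))
                (≤-trans (kraft a r) (^-monoʳ-≤ 2 (m≤n⊔m dl dr))) ⟩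
  2 ^ (dl ⊔ dr) + 2 ^ (dl ⊔ dr)
    ≡⟨ cong (2 ^ (dl ⊔ dr) +_) (sym (+-identityʳ (2 ^ (dl ⊔ dr)))) ⟩
  2 ^ suc (dl ⊔ dr) ∎
  where
  open ≤-Reasoning
  dl dr : ℕ
  dl = delay a l
  dr = delay a r

symTree-leaves-↭ : ∀ {X : A → Set} t t' →
                   IsSymTree X t → IsSymTree X t' → leaves t ↭ leaves t'
symTree-leaves-↭ _ _ (u , t≈X) (u' , t'≈X) = ∼bag⇒↭ (unique∧set⇒bag u u' λ {x} →
  mk⇔ (from (t'≈X x) ∘ to (t≈X x)) (from (t≈X x) ∘ to (t'≈X x)))

-- Merging pieces

-- A piece is a tree with a level d; 2^d is its share of the Kraft sum.
Piece : ℕ → ℕ → Set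
Piece n m = RTree n m × ℕ

pieceLeaves : List (Piece n m) → List (Inp n m)
pieceLeaves = concatMap (leaves ∘ expand ∘ proj₁)

cost : List (Piece n m) → ℕ
cost = sum ∘ map (suc ∘ newGates ∘ proj₁)

weight : List (Piece n m) → ℕ
weight = sum ∘ map ((2 ^_) ∘ proj₂)

-- After s merging rounds a piece of level d has delay at most s + d.
Fits : (Inp n m → ℕ) → ℕ → Piece n m → Set
Fits a s (r , d) = ReusesS r × delay a (expand r) ≤ s + d

Admissible : (Inp n m → ℕ) → Piece n m → Set
Admissible a (r , d) = Fits a 0 (r , d) × 2 ^ d ≤ kraftSum a (leaves (expand r))

pieceLeaves-++ : ∀ (U V : List (Piece n m)) →
                 pieceLeaves (U ++ V) ≡ pieceLeaves U ++ pieceLeaves V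
pieceLeaves-++ U V = trans (cong concat (map-++ _ U V)) (sym (concat-++ (map _ U) (map _ V)))

cost-++ : ∀ (U V : List (Piece n m)) → cost (U ++ V) ≡ cost U + cost V
cost-++ U V = trans (cong sum (map-++ _ U V)) (sum-++ (map _ U) _)

weight≤kraftSum : ∀ (a : Inp n m → ℕ) {U} → All (Admissible a) U →
                  weight U ≤ kraftSum a (pieceLeaves U)
weight≤kraftSum a []                        = z≤n
weight≤kraftSum a {(r , d) ∷ U} ((_ , h) ∷ hs) =
  ≤-trans (+-mono-≤ h (weight≤kraftSum a hs))
          (≤-reflexive (sym (kraftSum-++ a (leaves (expand r)) (pieceLeaves U))))

-- One round; the optional tree is a level-0 piece still waiting for a partner.
pending : Maybe (RTree n m) → List (Piece n m)
pending nothing  = []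
pending (just r) = (r , 0) ∷ []

round : Maybe (RTree n m) → List (Piece n m) → List (Piece n m)
round nothing  []                = []
round (just r) []                = (r , 0) ∷ []
round nothing  ((r , zero) ∷ U)  = round (just r) U
round (just q) ((r , zero) ∷ U)  = (new q r , 0) ∷ round nothing U
round p        ((r , suc d) ∷ U) = (r , d) ∷ round p U

round-leaves : ∀ p (U : List (Piece n m)) →
               pieceLeaves (round p U) ↭ pieceLeaves (pending p ++ U)
round-leaves nothing  []                = ↭-refl
round-leaves (just r) []                = ↭-refl
round-leaves nothing  ((r , zero) ∷ U)  = round-leaves (just r) U
round-leaves (just q) ((r , zero) ∷ U)  =
  ↭-trans (++⁺ˡ (leaves (expand q) ++ leaves (expand r)) (round-leaves nothing U))
          (↭-reflexive (++-assoc (leaves (expand q)) _ _))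
round-leaves nothing  ((r , suc d) ∷ U) = ++⁺ˡ (leaves (expand r)) (round-leaves nothing U)
round-leaves (just q) ((r , suc d) ∷ U) =
  ↭-trans (++⁺ˡ (leaves (expand r)) (round-leaves (just q) U))
          (shifts (leaves (expand r)) (leaves (expand q)))

round-cost : ∀ p (U : List (Piece n m)) → cost (round p U) ≡ cost (pending p ++ U)
round-cost nothing  []                = refl
round-cost (just r) []                = refl
round-cost nothing  ((r , zero) ∷ U)  = round-cost (just r) U
round-cost (just q) ((r , zero) ∷ U)  = begin
  suc (suc (newGates q + newGates r)) + cost (round nothing U)
    ≡⟨ cong (suc (suc (newGates q + newGates r)) +_) (round-cost nothing U) ⟩
  suc (suc (newGates q + newGates r + cost U))
    ≡⟨ cong (suc ∘ suc) (+-assoc (newGates q) (newGates r) (cost U)) ⟩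
  suc (suc (newGates q + (newGates r + cost U)))
    ≡⟨ cong suc (sym (+-suc (newGates q) (newGates r + cost U))) ⟩
  suc (newGates q) + (suc (newGates r) + cost U) ∎
  where open ≡-Reasoning
round-cost nothing  ((r , suc d) ∷ U) = cong (suc (newGates r) +_) (round-cost nothing U)
round-cost (just q) ((r , suc d) ∷ U) =
  trans (cong (suc (newGates r) +_) (round-cost (just q) U))
        (x∙yz≈y∙xz (suc (newGates r)) (suc (newGates q)) (cost U))

lowered-weight : ∀ p (r : RTree n m) {d w} U → 2 * w ≤ suc (weight (pending p ++ U)) →
                 2 * (2 ^ d + w) ≤ suc (weight (pending p ++ (r , suc d) ∷ U))
lowered-weight p r {d} {w} U 2w≤ = begin
  2 * (2 ^ d + w)                           ≡⟨ *-distribˡ-+ 2 (2 ^ d) w ⟩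
  2 ^ suc d + 2 * w                         ≤⟨ +-monoʳ-≤ (2 ^ suc d) 2w≤ ⟩
  2 ^ suc d + suc (weight (pending p ++ U)) ≡⟨ +-suc (2 ^ suc d) _ ⟩
  suc (2 ^ suc d + weight (pending p ++ U)) ≡⟨ cong suc (insert p) ⟩
  suc (weight (pending p ++ (r , suc d) ∷ U)) ∎
  where
  open ≤-Reasoning
  insert : ∀ p → 2 ^ suc d + weight (pending p ++ U) ≡ weight (pending p ++ (r , suc d) ∷ U)
  insert nothing  = refl
  insert (just q) = x∙yz≈y∙xz (2 ^ suc d) 1 (weight U)

-- The suc absorbs an unpaired piece of level 0.
round-weight : ∀ p (U : List (Piece n m)) →
               2 * weight (round p U) ≤ suc (weight (pending p ++ U))
round-weight nothing  []                = z≤n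
round-weight (just r) []                = ≤-refl
round-weight nothing  ((r , zero) ∷ U)  = round-weight (just r) U
round-weight (just q) ((r , zero) ∷ U)  =
  ≤-trans (≤-reflexive (*-suc 2 (weight (round nothing U))))
          (s≤s (s≤s (round-weight nothing U)))
round-weight nothing  ((r , suc d) ∷ U) = lowered-weight nothing  r {d} U (round-weight nothing U)
round-weight (just q) ((r , suc d) ∷ U) = lowered-weight (just q) r {d} U (round-weight (just q) U)

round-fits : ∀ (a : Inp n m → ℕ) {s} p U →
             All (Fits a s) (pending p ++ U) → All (Fits a (suc s)) (round p U)
round-fits a nothing  []                []                          = []
round-fits a (just r) []                ((re , dl) ∷ [])            = (re , m≤n⇒m≤1+n dl) ∷ []
round-fits a nothing  ((r , zero) ∷ U)  fs                          = round-fits a (just r) U fs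
round-fits a (just q) ((r , zero) ∷ U)  ((req , dq) ∷ (rer , dr) ∷ fs) =
  ((req , rer) , s≤s (⊔-lub dq dr)) ∷ round-fits a nothing U fs
round-fits a {s} nothing  ((r , suc d) ∷ U) ((re , dl) ∷ fs)        =
  (re , ≤-trans dl (≤-reflexive (+-suc s d))) ∷ round-fits a nothing U fs
round-fits a {s} (just q) ((r , suc d) ∷ U) (fq ∷ (re , dl) ∷ fs)   =
  (re , ≤-trans dl (≤-reflexive (+-suc s d))) ∷ round-fits a (just q) U (fq ∷ fs)

round-nonempty : ∀ p (U : List (Piece n m)) →
                 0 < length (pending p ++ U) → 0 < length (round p U)
round-nonempty nothing  []                ()
round-nonempty (just r) []                _ = z<s
round-nonempty nothing  ((r , zero) ∷ U)  _ = round-nonempty (just r) U z<s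
round-nonempty (just q) ((r , zero) ∷ U)  _ = z<s
round-nonempty nothing  ((r , suc d) ∷ U) _ = z<s
round-nonempty (just q) ((r , suc d) ∷ U) _ = z<s

record Merge (a : Inp n m → ℕ) (U : List (Piece n m)) (δ : ℕ) : Set where
  field
    tree    : RTree n m
    leaves↭ : leaves (expand tree) ↭ pieceLeaves U
    gates   : suc (newGates tree) ≡ cost U
    reuses  : ReusesS tree
    delay≤  : delay a (expand tree) ≤ δ

merge : ∀ (a : Inp n m → ℕ) E s U →
        0 < length U → weight U ≤ 2 ^ E → All (Fits a s) U → Merge a U (s + E)
merge a zero s ((r , zero) ∷ []) _ _ ((re , dl) ∷ []) = record
  { tree    = r
  ; leaves↭ = ↭-reflexive (sym (++-identityʳ _))
  ; gates   = sym (+-identityʳ _)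
  ; reuses  = re
  ; delay≤  = dl
  }
merge a zero s ((r , zero) ∷ (_ , d) ∷ U) _ (s≤s W≤0) _ =
  ⊥-elim (<⇒≱ (m^n>0 2 d) (≤-trans (m≤m+n (2 ^ d) _) W≤0))
merge a zero s ((r , suc d) ∷ U) _ W≤1 _ =
  ⊥-elim (<⇒≱ (^-monoʳ-< 2 (s≤s (s≤s z≤n)) (z<s {d}))
              (≤-trans (m≤m+n (2 ^ suc d) _) W≤1))
merge a (suc E) s U nonempty W≤2^[1+E] fits = record
  { tree    = tree
  ; leaves↭ = ↭-trans leaves↭ (round-leaves nothing U)
  ; gates   = trans gates (round-cost nothing U)
  ; reuses  = reuses
  ; delay≤  = ≤-trans delay≤ (≤-reflexive (sym (+-suc s E)))
  }
  where
  halved : weight (round nothing U) ≤ 2 ^ E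
  halved = 2*x≤1+2*y⇒x≤y (≤-trans (round-weight nothing U) (s≤s W≤2^[1+E]))
  open Merge (merge a E (suc s) (round nothing U) (round-nonempty nothing U nonempty) halved
                    (round-fits a nothing U fits))

∈pieceLeaves⇒nonempty : ∀ {U : List (Piece n m)} {x} → x ∈ pieceLeaves U → 0 < length U
∈pieceLeaves⇒nonempty {U = _ ∷ _} _ = z<s

optimal-merge : ∀ (a : Inp n m → ℕ) (X : Inp n m → Set) U →
  (∀ x → x ∈ pieceLeaves U ⇔ X x) → Unique (pieceLeaves U) → Σ (Inp n m) X →
  All (Admissible a) U →
  Σ (RTree n m) λ t → ReusesS t × IsSymTree X (expand t)
    × (∀ (t' : BTree (Inp n m)) → IsSymTree X t' → delay a (expand t) ≤ delay a t')
    × suc (newGates t) ≡ cost U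
optimal-merge a X U U≈X unique (x , x∈X) admissible =
  tree , reuses , symmetric , optimal , gates
  where
  exponent : Σ ℕ λ e → weight U ≤ 2 ^ e × (∀ {d} → weight U ≤ 2 ^ d → e ≤ d)
  exponent = least-exponent (weight U)
  open Merge (merge a (proj₁ exponent) 0 U
                    (∈pieceLeaves⇒nonempty {U = U} (from (U≈X x) x∈X))
                    (proj₁ (proj₂ exponent)) (All.map proj₁ admissible))

  symmetric : IsSymTree X (expand tree)
  symmetric = unique-resp-↭ unique (↭-sym leaves↭)
            , λ y → mk⇔ (to (U≈X y) ∘ ∈-resp-↭ leaves↭)
                        (∈-resp-↭ (↭-sym leaves↭) ∘ from (U≈X y))

  optimal : ∀ t' → IsSymTree X t' → delay a (expand tree) ≤ delay a t'
  optimal t' t'-symmetric = ≤-trans delay≤ (proj₂ (proj₂ exponent) (begin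
    weight U                   ≤⟨ weight≤kraftSum a admissible ⟩
    kraftSum a (pieceLeaves U) ≡⟨ kraftSum-↭ a (↭-trans (↭-sym leaves↭) t↭t') ⟩
    kraftSum a (leaves t')     ≤⟨ kraft a t' ⟩
    2 ^ delay a t'             ∎))
    where
    open ≤-Reasoning
    t↭t' : leaves (expand tree) ↭ leaves t'
    t↭t' = symTree-leaves-↭ (expand tree) t' symmetric t'-symmetric

∈I-leaf : ∀ j → j ∈I vtx j 0
∈I-leaf j = ≤-refl , m<m+n j z<s

∈I-leaf⁻ : ∀ {i j} → i ∈I vtx j 0 → i ≡ j
∈I-leaf⁻ {j = j} (lo , hi) = ≤-antisym (≤-pred (≤-trans hi (≤-reflexive (+-comm j 1)))) lo

perfect-∈⁻ : ∀ j h (p : j + 2 ^ h ≤ n) {x} →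
             x ∈ leaves (perfect j h p) → toℕ x ∈I vtx j h
perfect-∈⁻ j zero    p (here refl) = subst (_∈I vtx j 0) (sym (toℕ-fromℕ< _)) (∈I-leaf j)
perfect-∈⁻ j (suc h) p x∈ with ∈-++⁻ (leaves (perfect j h _)) x∈
... | inj₁ x∈ˡ = let lo , hi = perfect-∈⁻ j h _ x∈ˡ in
  lo , <-≤-trans hi (+-monoʳ-≤ j (^-monoʳ-≤ 2 (n≤1+n h)))
... | inj₂ x∈ʳ = let lo , hi = perfect-∈⁻ (j + 2 ^ h) h _ x∈ʳ in
  ≤-trans (m≤m+n j _) lo , <-≤-trans hi (≤-reflexive (j+2^h+2^h≡j+2^[1+h] j h))

perfect-∈⁺ : ∀ j h (p : j + 2 ^ h ≤ n) {x} →
             toℕ x ∈I vtx j h → x ∈ leaves (perfect j h p)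
perfect-∈⁺ j zero    p x∈ = here (toℕ-injective (trans (∈I-leaf⁻ x∈) (sym (toℕ-fromℕ< _))))
perfect-∈⁺ j (suc h) p {x} (lo , hi) with toℕ x <? j + 2 ^ h
... | yes x<mid = ∈-++⁺ˡ (perfect-∈⁺ j h _ (lo , x<mid))
... | no  x≮mid = ∈-++⁺ʳ _ (perfect-∈⁺ (j + 2 ^ h) h _
                    (≮⇒≥ x≮mid , <-≤-trans hi (≤-reflexive (sym (j+2^h+2^h≡j+2^[1+h] j h)))))

perfect-sorted : ∀ j h (p : j + 2 ^ h ≤ n) →
                 AllPairs (λ x y → toℕ x < toℕ y) (leaves (perfect j h p))
perfect-sorted j zero    p = [] ∷ []
perfect-sorted j (suc h) p = AllPairs.++⁺ (perfect-sorted j h _) (perfect-sorted (j + 2 ^ h) h _)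
  (All.tabulate λ x∈ → All.tabulate λ y∈ →
    <-≤-trans (proj₂ (perfect-∈⁻ j h _ x∈)) (proj₁ (perfect-∈⁻ (j + 2 ^ h) h _ y∈)))

length-perfect : ∀ j h (p : j + 2 ^ h ≤ n) → length (leaves (perfect j h p)) ≡ 2 ^ h
length-perfect j zero    p = refl
length-perfect j (suc h) p = begin
  length (leaves (perfect j h _) ++ leaves (perfect (j + 2 ^ h) h _))
    ≡⟨ length-++ (leaves (perfect j h _)) ⟩
  length (leaves (perfect j h _)) + length (leaves (perfect (j + 2 ^ h) h _))
    ≡⟨ cong₂ _+_ (length-perfect j h _) (length-perfect (j + 2 ^ h) h _) ⟩
  2 ^ h + 2 ^ h
    ≡⟨ cong (2 ^ h +_) (sym (+-identityʳ (2 ^ h))) ⟩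
  2 ^ suc h ∎
  where open ≡-Reasoning

perfect-delay : ∀ (b : Fin n → ℕ) j h (p : j + 2 ^ h ≤ n) →
                (∀ {x} → x ∈ leaves (perfect j h p) → b x ≡ 0) → delay b (perfect j h p) ≤ h
perfect-delay b j zero    p b≡0 = ≤-reflexive (b≡0 (here refl))
perfect-delay b j (suc h) p b≡0 =
  s≤s (⊔-lub (perfect-delay b j h _ (λ x∈ → b≡0 (∈-++⁺ˡ x∈)))
             (perfect-delay b (j + 2 ^ h) h _ (λ x∈ → b≡0 (∈-++⁺ʳ _ x∈))))

-- Vertices of the leftist circuit

blocksGo-end≤ : ∀ fuel i M {s k} → (s , k) ∈ blocksGo fuel i M → s + 2 ^ k ≤ i + M
blocksGo-end≤ (suc fuel) i (suc (suc M)) (here refl) = +-monoʳ-≤ i (2^⌊log₂n⌋≤n (suc (suc M)))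
blocksGo-end≤ (suc fuel) i (suc (suc M)) (there b∈) = begin
  _                          ≤⟨ blocksGo-end≤ fuel _ _ b∈ ⟩
  i + 2 ^ k + (M' ∸ 2 ^ k)   ≡⟨ +-assoc i (2 ^ k) _ ⟩
  i + (2 ^ k + (M' ∸ 2 ^ k)) ≡⟨ cong (i +_) (m+[n∸m]≡n (2^⌊log₂n⌋≤n M')) ⟩
  i + M'                     ∎
  where
  open ≤-Reasoning
  M' k : ℕ
  M' = suc (suc M)
  k  = ⌊log₂ M' ⌋

vertex-end≤n : ∀ {v} → IsVertex n v → vend v ≤ n
vertex-end≤n {v = vtx j zero}    j<n = ≤-trans (≤-reflexive (+-comm j 1)) j<n
vertex-end≤n {n} {v = vtx j (suc h)} (_ , b∈ , _ , _ , _ , end≤) =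
  ≤-trans end≤ (blocksGo-end≤ n 0 n b∈)

height<n : ∀ {v} → IsVertex n v → height v < n
height<n {v = v} v∈S =
  <-≤-trans (n<2^n (height v)) (≤-trans (m≤n+m _ (start v)) (vertex-end≤n v∈S))

IsVertex? : ∀ n v → Dec (IsVertex n v)
IsVertex? n (vtx j zero)    = j <? n
IsVertex? n (vtx j (suc h)) =
  map′ (λ any → let b , b∈ , q = find any in b , b∈ , q) (λ (b , b∈ , q) → lose b∈ q)
       (any? (λ (s , k) → suc h ≤? k ×-dec s ≤? j ×-dec 2 ^ suc h ∣? (j ∸ s)
                          ×-dec j + 2 ^ suc h ≤? s + 2 ^ k)
             (leftistBlocks n))

IsPred? : ∀ n v w → Dec (IsPred n v w)
IsPred? n v w = IsVertex? n w ×-dec height w ≟ suc (height v)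
                ×-dec (start v ≟ start w ⊎-dec start v ≟ start w + 2 ^ height v)

InSub? : ∀ (K : Subset n) v → Dec (InSub K v)
InSub? K v = Finₚ.all? λ i → (start v ≤? toℕ i ×-dec toℕ i <? vend v) →-dec (i ∈? K)

-- v is the left child of the first candidate and the right child of the second.
successorCandidates : Vtx → List Vtx
successorCandidates v =
  vtx (start v) (suc (height v)) ∷ vtx (start v ∸ 2 ^ height v) (suc (height v)) ∷ []

successor∈candidates : ∀ {v w} → IsPred n v w → w ∈ successorCandidates v
successor∈candidates {v = v} {vtx j _} (_ , refl , inj₁ v-left)  =
  here (cong (λ z → vtx z (suc (height v))) (sym v-left))
successor∈candidates {v = v} {vtx j _} (_ , refl , inj₂ v-right) =
  there (here (cong (λ z → vtx z (suc (height v)))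
    (trans (sym (m+n∸n≡m j (2 ^ height v))) (cong (_∸ 2 ^ height v) (sym v-right)))))

successor-⊇ : ∀ {v w i} → IsPred n v w → i ∈I v → i ∈I w
successor-⊇ {v = v} {vtx j _} {i} (_ , refl , inj₁ v-left) (lo , hi) =
  subst (_≤ i) v-left lo ,
  <-≤-trans hi (≤-trans (+-monoʳ-≤ (start v) (^-monoʳ-≤ 2 (n≤1+n (height v))))
                        (≤-reflexive (cong (_+ 2 ^ suc (height v)) v-left)))
successor-⊇ {v = v} {vtx j _} (_ , refl , inj₂ v-right) (lo , hi) =
  ≤-trans (m≤m+n j _) (≤-trans (≤-reflexive (sym v-right)) lo) ,
  <-≤-trans hi (≤-reflexive (trans (cong (_+ 2 ^ height v) v-right)
                                   (j+2^h+2^h≡j+2^[1+h] j (height v))))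

-- Climb while some successor keeps all its inputs in K; vertex heights stay below n.
ascend : ∀ (K : Subset n) fuel v → n ≤ height v + fuel → IsVertex n v → InSub K v →
         Σ Vtx λ w → IsBoundary K w × (∀ {i} → i ∈I v → i ∈I w)
ascend {n} K fuel v n≤ v∈S v⊆K
  with any? (λ w → IsPred? n v w ×-dec InSub? K w) (successorCandidates v)
... | no none =
  v , (v∈S , v⊆K , λ w v→w w⊆K → none (lose (successor∈candidates v→w) (v→w , w⊆K))) , id
ascend {n} K zero v n≤ v∈S v⊆K | yes some =
  let _ , _ , (w∈S , h≡ , _) , _ = find some in
  ⊥-elim (<⇒≱ (subst (_< n) h≡ (height<n w∈S))
              (≤-trans n≤ (≤-trans (≤-reflexive (+-identityʳ _)) (n≤1+n _))))
ascend K (suc fuel) v n≤ v∈S v⊆K | yes some =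
  let w , _ , v→w@(w∈S , h≡ , _) , w⊆K = find some
      n≤h+fuel = ≤-trans n≤ (≤-reflexive (trans (+-suc _ fuel) (cong (_+ fuel) (sym h≡))))
      u , u-boundary , w⊆u = ascend K fuel w n≤h+fuel w∈S w⊆K
  in u , u-boundary , w⊆u ∘ successor-⊇ v→w

boundary-above : ∀ (K : Subset n) {i} → i ∈ₛ K → Σ Vtx λ w → IsBoundary K w × toℕ i ∈I w
boundary-above {n} K {i} i∈K =
  let w , w-boundary , ⊆w = ascend K n (vtx (toℕ i) 0) ≤-refl (toℕ<n i) input⊆K in
  w , w-boundary , ⊆w (∈I-leaf (toℕ i))
  where
  input⊆K : InSub K (vtx (toℕ i) 0)
  input⊆K j j∈ = subst (_∈ₛ K) (sym (toℕ-injective (∈I-leaf⁻ j∈))) i∈K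

LeftOf-trans : ∀ {u v w} → LeftOf u v → LeftOf v w → LeftOf u w
LeftOf-trans {v = v} u<v v<w = ≤-trans u<v (≤-trans (m≤m+n (start v) _) v<w)

-- The pieces of the leftist circuit

blockPieces : ∀ {K : Subset n} → All (IsBoundary K) vs → List (Piece n m)
blockPieces []                    = []
blockPieces (_∷_ {x = v} v-bd βs) =
  (old (start v) (height v) (vertex-end≤n (proj₁ v-bd)) , height v) ∷ blockPieces βs

blockInputs : ∀ {K : Subset n} → All (IsBoundary K) vs → List (Fin n)
blockInputs []                    = []
blockInputs (_∷_ {x = v} v-bd βs) =
  leaves (perfect (start v) (height v) (vertex-end≤n (proj₁ v-bd))) ++ blockInputs βs

pieceLeaves-blockPieces : ∀ {K : Subset n} (βs : All (IsBoundary K) vs) →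
                          pieceLeaves (blockPieces {m = m} βs) ≡ map inj₁ (blockInputs βs)
pieceLeaves-blockPieces []                    = refl
pieceLeaves-blockPieces {n} (_∷_ {x = v} v-bd βs) =
  trans (cong₂ _++_ (leaves-mapB inj₁ T) (pieceLeaves-blockPieces βs))
        (sym (map-++ inj₁ (leaves T) (blockInputs βs)))
  where
  T : BTree (Fin n)
  T = perfect (start v) (height v) (vertex-end≤n (proj₁ v-bd))

blockInputs-∈⁻ : ∀ {K : Subset n} (βs : All (IsBoundary K) vs) {i} →
                 i ∈ blockInputs βs → Σ Vtx λ v → v ∈ vs × toℕ i ∈I v
blockInputs-∈⁻ (_∷_ {x = v} v-bd βs) i∈ with ∈-++⁻ (leaves (perfect (start v) (height v) _)) i∈
... | inj₁ i∈v  = v , here refl , perfect-∈⁻ (start v) (height v) _ i∈v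
... | inj₂ i∈βs = let w , w∈ , i∈w = blockInputs-∈⁻ βs i∈βs in w , there w∈ , i∈w

blockInputs-∈⁺ : ∀ {K : Subset n} (βs : All (IsBoundary K) vs) {i v} →
                 v ∈ vs → toℕ i ∈I v → i ∈ blockInputs βs
blockInputs-∈⁺ (_∷_ {x = v} v-bd βs) (here refl) i∈v =
  ∈-++⁺ˡ (perfect-∈⁺ (start v) (height v) _ i∈v)
blockInputs-∈⁺ (v-bd ∷ βs) (there v∈) i∈v = ∈-++⁺ʳ _ (blockInputs-∈⁺ βs v∈ i∈v)

blockInputs⊆K : ∀ {K : Subset n} (βs : All (IsBoundary K) vs) {i} → i ∈ blockInputs βs → i ∈ₛ K
blockInputs⊆K βs i∈ =
  let v , v∈ , i∈v = blockInputs-∈⁻ βs i∈ in proj₁ (proj₂ (All.lookup βs v∈)) _ i∈v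

blockInputs-sorted : ∀ {K : Subset n} (βs : All (IsBoundary K) vs) → AllPairs LeftOf vs →
                     AllPairs (λ x y → toℕ x < toℕ y) (blockInputs βs)
blockInputs-sorted [] [] = []
blockInputs-sorted (_∷_ {x = v} v-bd βs) (v-left ∷ sorted) =
  AllPairs.++⁺ (perfect-sorted (start v) (height v) _) (blockInputs-sorted βs sorted)
    (All.tabulate λ x∈ → All.tabulate λ y∈ →
      let w , w∈ , (w≤y , _) = blockInputs-∈⁻ βs y∈ in
      <-≤-trans (proj₂ (perfect-∈⁻ (start v) (height v) _ x∈))
                (≤-trans (All.lookup v-left w∈) w≤y))

blockPieces-admissible : ∀ {K : Subset n} (a : Inp n m → ℕ) → (∀ i → i ∈ₛ K → a (inj₁ i) ≡ 0) →
                         (βs : All (IsBoundary K) vs) → All (Admissible a) (blockPieces βs)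
blockPieces-admissible a a[K]≡0 []                    = []
blockPieces-admissible {n} a a[K]≡0 (_∷_ {x = v} v-bd βs) =
  ((proj₁ v-bd , delay≤height) , 2^height≤kraftSum) ∷ blockPieces-admissible a a[K]≡0 βs
  where
  T : BTree (Fin n)
  T = perfect (start v) (height v) (vertex-end≤n (proj₁ v-bd))
  delay≤height : delay a (mapB inj₁ T) ≤ height v
  delay≤height = ≤-trans (≤-reflexive (delay-mapB inj₁ a T))
    (perfect-delay (a ∘ inj₁) (start v) (height v) _ λ x∈ →
      a[K]≡0 _ (proj₁ (proj₂ v-bd) _ (perfect-∈⁻ (start v) (height v) _ x∈)))
  2^height≤kraftSum : 2 ^ height v ≤ kraftSum a (leaves (mapB inj₁ T))
  2^height≤kraftSum = begin
    2 ^ height v                      ≡⟨ sym (length-perfect (start v) (height v) _) ⟩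
    length (leaves T)                 ≡⟨ sym (length-map inj₁ (leaves T)) ⟩
    length (map inj₁ (leaves T))      ≡⟨ cong length (sym (leaves-mapB inj₁ T)) ⟩
    length (leaves (mapB inj₁ T))     ≤⟨ length≤kraftSum a (leaves (mapB inj₁ T)) ⟩
    kraftSum a (leaves (mapB inj₁ T)) ∎
    where open ≤-Reasoning hiding (start)

cost-blockPieces : ∀ {K : Subset n} (βs : All (IsBoundary K) vs) →
                   cost (blockPieces {m = m} βs) ≡ length vs
cost-blockPieces []          = refl
cost-blockPieces (v-bd ∷ βs) = cong suc (cost-blockPieces βs)

inputPieces : (Inp n m → ℕ) → List (Inp n m) → List (Piece n m)
inputPieces a = map λ x → inp x , a x

pieceLeaves-inputPieces : ∀ (a : Inp n m → ℕ) xs → pieceLeaves (inputPieces a xs) ≡ xs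
pieceLeaves-inputPieces a []       = refl
pieceLeaves-inputPieces a (x ∷ xs) = cong (x ∷_) (pieceLeaves-inputPieces a xs)

inputPieces-admissible : ∀ (a : Inp n m → ℕ) xs → All (Admissible a) (inputPieces a xs)
inputPieces-admissible a xs = All.map⁺ (All.universal (λ x → (tt , ≤-refl) , m≤m+n _ 0) xs)

cost-inputPieces : ∀ (a : Inp n m → ℕ) xs → cost (inputPieces a xs) ≡ length xs
cost-inputPieces a []       = refl
cost-inputPieces a (x ∷ xs) = cong suc (cost-inputPieces a xs)

module LeftistPieces (K L₁ : Subset n) (L₂ : Subset m) (a : Inp n m → ℕ)
                     (βs : All (IsBoundary K) vs) where

  extraInputs : List (Inp n m)
  extraInputs = map inj₁ (members L₁) ++ map inj₂ (members L₂)

  pieces : List (Piece n m)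
  pieces = blockPieces βs ++ inputPieces a extraInputs

  allInputs : List (Inp n m)
  allInputs = map inj₁ (blockInputs βs ++ members L₁) ++ map inj₂ (members L₂)

  pieceLeaves-pieces : pieceLeaves pieces ≡ allInputs
  pieceLeaves-pieces = begin
    pieceLeaves pieces
      ≡⟨ pieceLeaves-++ (blockPieces βs) _ ⟩
    pieceLeaves (blockPieces βs) ++ pieceLeaves (inputPieces a extraInputs)
      ≡⟨ cong₂ _++_ (pieceLeaves-blockPieces βs) (pieceLeaves-inputPieces a extraInputs) ⟩
    map inj₁ (blockInputs βs) ++ (map inj₁ (members L₁) ++ map inj₂ (members L₂))
      ≡⟨ sym (++-assoc (map inj₁ (blockInputs βs)) _ _) ⟩
    (map inj₁ (blockInputs βs) ++ map inj₁ (members L₁)) ++ map inj₂ (members L₂)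
      ≡⟨ cong (_++ _) (sym (map-++ inj₁ (blockInputs βs) (members L₁))) ⟩
    allInputs ∎
    where open ≡-Reasoning

  pieces-unique : AllPairs LeftOf vs → Empty (K ∩ L₁) → Unique (pieceLeaves pieces)
  pieces-unique sorted K∩L₁=∅ = subst Unique (sym pieceLeaves-pieces)
    (unique-map-inj₁-++-map-inj₂
      (Unique.++⁺ blockInputs-unique (members-unique L₁) disjoint) (members-unique L₂))
    where
    blockInputs-unique : Unique (blockInputs βs)
    blockInputs-unique =
      AllPairs.map (λ x<y x≡y → <-irrefl (cong toℕ x≡y) x<y) (blockInputs-sorted βs sorted)
    disjoint : Disjoint (blockInputs βs) (members L₁)
    disjoint {i} (i∈K , i∈L₁) = K∩L₁=∅ (i , x∈p∩q⁺ (blockInputs⊆K βs i∈K , ∈-members⁻ L₁ i∈L₁))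

  ∈-pieces : (∀ {v} → IsBoundary K v → v ∈ vs) → ∀ x → x ∈ pieceLeaves pieces ⇔ InKL K L₁ L₂ x
  ∈-pieces complete x = mk⇔ (sound x ∘ subst (x ∈_) pieceLeaves-pieces)
                            (subst (x ∈_) (sym pieceLeaves-pieces) ∘ exhaustive x)
    where
    sound : ∀ x → x ∈ allInputs → InKL K L₁ L₂ x
    sound (inj₁ i) i∈ with ∈-++⁻ (blockInputs βs) (inj₁-∈-++⁻ i∈)
    ... | inj₁ i∈K  = inj₁ (blockInputs⊆K βs i∈K)
    ... | inj₂ i∈L₁ = inj₂ (∈-members⁻ L₁ i∈L₁)
    sound (inj₂ j) j∈ = ∈-members⁻ L₂ (inj₂-∈-++⁻ j∈)
    exhaustive : ∀ x → InKL K L₁ L₂ x → x ∈ allInputs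
    exhaustive (inj₁ i) (inj₁ i∈K) =
      let w , w-boundary , i∈w = boundary-above K i∈K in
      ∈-++⁺ˡ (∈-map⁺ inj₁ (∈-++⁺ˡ (blockInputs-∈⁺ βs (complete w-boundary) i∈w)))
    exhaustive (inj₁ i) (inj₂ i∈L₁) =
      ∈-++⁺ˡ (∈-map⁺ inj₁ (∈-++⁺ʳ (blockInputs βs) (∈-members⁺ L₁ i∈L₁)))
    exhaustive (inj₂ j) j∈L₂ = ∈-++⁺ʳ _ (∈-map⁺ inj₂ (∈-members⁺ L₂ j∈L₂))

  pieces-admissible : (∀ i → i ∈ₛ K → a (inj₁ i) ≡ 0) → All (Admissible a) pieces
  pieces-admissible a[K]≡0 =
    All.++⁺ (blockPieces-admissible a a[K]≡0 βs) (inputPieces-admissible a extraInputs)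

  cost-pieces : cost pieces ≡ length vs + (∣ L₁ ∣ + ∣ L₂ ∣)
  cost-pieces = begin
    cost pieces
      ≡⟨ cost-++ (blockPieces βs) _ ⟩
    cost (blockPieces βs) + cost (inputPieces a extraInputs)
      ≡⟨ cong₂ _+_ (cost-blockPieces βs) (cost-inputPieces a extraInputs) ⟩
    length vs + length (map inj₁ (members L₁) ++ map inj₂ (members L₂))
      ≡⟨ cong (length vs +_) (length-++ (map inj₁ (members L₁))) ⟩
    length vs + (length (map inj₁ (members L₁)) + length (map inj₂ (members L₂)))
      ≡⟨ cong (length vs +_) (cong₂ _+_ (trans (length-map inj₁ (members L₁)) (length-members L₁))
                                        (trans (length-map inj₂ (members L₂)) (length-members L₂))) ⟩
    length vs + (∣ L₁ ∣ + ∣ L₂ ∣) ∎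
    where open ≡-Reasoning

mainTheorem4 : (∘ : Op) (n m : ℕ) (K L₁ : Subset n) (L₂ : Subset m)
    (bs : List Vtx) →
    (∀ v → v ∈ bs ⇔ IsBoundary K v) → Linked LeftOf bs →
    Triangular K bs →
    Empty (K ∩ L₁) →
    Σ (Inp n m) (InKL K L₁ L₂) →
    (a : Inp n m → ℕ) → (∀ i → i ∈ₛ K → a (inj₁ i) ≡ 0) →
    Σ (RTree n m) λ t →
      ReusesS t × IsSymTree (InKL K L₁ L₂) (expand t)
      × (∀ (t' : BTree (Inp n m)) → IsSymTree (InKL K L₁ L₂) t' → delay a (expand t) ≤ delay a t')
      × newGates t ≤ length bs + (∣ L₁ ∣ + ∣ L₂ ∣) ∸ 1
mainTheorem4 _ n m K L₁ L₂ bs bs≈B bs-linked _ K∩L₁=∅ inhabited a a[K]≡0 =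
  let t , reuses , symmetric , optimal , gates =
        optimal-merge a (InKL K L₁ L₂) pieces (∈-pieces (λ {v} → from (bs≈B v)))
          (pieces-unique sorted K∩L₁=∅) inhabited (pieces-admissible a[K]≡0)
  in t , reuses , symmetric , optimal , ≤-reflexive (cong (_∸ 1) (trans gates cost-pieces))
  where
  open LeftistPieces K L₁ L₂ a (All.tabulate λ {v} → to (bs≈B v))
  sorted : AllPairs LeftOf bs
  sorted = Linked⇒AllPairs (λ {u v w} → LeftOf-trans {u} {v} {w}) bs-linked
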